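{- Let $n\ge1$, $x,y$ coprime with $1\le x<y$, consider the rotor multigraph $P^{x,y}_n$, and let $F=\sum_{i=0}^n x^{n-i}y^i$. For every integer $v$ with $0\le v\le F-1$, there is a unique $k\in\mathbb{N}$ such that $v+kF\in g(\mathcal{R})$, and this $k$ is the smallest $k\in\mathbb{N}$ with $c[v+kF]_{n+1}\ge0$.
   Context: $P^{x,y}_n$ has vertices $u_0,\dots,u_{n+1}$; $u_0,u_{n+1}$ are sinks and $V_0=\{u_1,\dots,u_n\}$. For $1\le k\le n$, $u_k$ has outgoing arcs $a^k_0,\dots,a^k_{x+y-1}$, with $a^k_i$ going to $u_{k+1}$ for $0\le i\le x-1$ and to $u_{k-1}$ for $x\le i\le x+y-1$. A rotor configuration assigns to each $u\in V_0$ an outgoing arc $\rho(u)$; $\mathcal{R}$ is their set. With $h(u_0)=0$, $h(u_k)=\sum_{i=0}^{k-1}x^{n-i}y^i$, define $g(a^k_j)=\sum_{i=0}^{j-1}\big(h(\mathrm{head}(a^k_i))-h(u_k)\big)$, $g(\rho)=\sum_{u\in V_0}g(\rho(u))$ and $g(\mathcal{R})=\{g(\rho):\rho\in\mathcal{R}\}$. Let $d_k=x^{n-k}y^k$ ($0\le k\le n+1$); for an integer $w\ge0$, $c[w]=(c_0,\dots,c_{n+1})$ is the unique tuple with $w=\sum_{k=0}^{n+1}c_kd_k$, $c_k\in\{0,\dots,y-1\}$ for $k\le n$ and $c_{n+1}\in x\mathbb{Z}$, and $c[w]_{n+1}$ denotes its last coordinate. $\mathbb{N}=\{0,1,2,\dots\}$.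 -}

module Defs where

open import Data.Nat as ℕ using (ℕ; zero; suc; _∸_; _^_; _<ᵇ_)
open import Data.Integer as ℤ using (ℤ; +_; _-_)
open import Data.Integer.Divisibility using () renaming (_∣_ to _∣ℤ_)
open import Data.Fin as Fin using (Fin; toℕ)
open import Data.Bool using (if_then_else_)
open import Data.Product using (Σ; _×_; ∃)
open import Relation.Binary.PropositionalEquality using (_≡_)

sumℕ : ℕ → (ℕ → ℕ) → ℕ
sumℕ zero    f = 0
sumℕ (suc m) f = sumℕ m f ℕ.+ f m

sumℤ : ℕ → (ℕ → ℤ) → ℤ
sumℤ zero    f = + 0
sumℤ (suc m) f = sumℤ m f ℤ.+ f m

sumFinℕ : (m : ℕ) → (Fin m → ℕ) → ℕ
sumFinℕ zero    f = 0
sumFinℕ (suc m) f = f Fin.zero ℕ.+ sumFinℕ m (λ i → f (Fin.suc i))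

sumFinℤ : (m : ℕ) → (Fin m → ℤ) → ℤ
sumFinℤ zero    f = + 0
sumFinℤ (suc m) f = f Fin.zero ℤ.+ sumFinℤ m (λ i → f (Fin.suc i))

bigF : ℕ → ℕ → ℕ → ℕ
bigF n x y = sumℕ (suc n) (λ i → x ^ (n ∸ i) ℕ.* y ^ i)

-- h(u_k) = Σ_{i=0}^{k-1} x^{n-i} y^i   (so h(u_0) = 0)
h : ℕ → ℕ → ℕ → ℕ → ℕ
h n x y k = sumℕ k (λ i → x ^ (n ∸ i) ℕ.* y ^ i)

-- index of head(a^k_i) (for 1 ≤ k ≤ n): u_{k+1} if i < x, u_{k-1} otherwise
headIdx : ℕ → ℕ → ℕ → ℕ
headIdx x k i = if i <ᵇ x then suc k else k ∸ 1

gArc : ℕ → ℕ → ℕ → ℕ → ℕ → ℤ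
gArc n x y k j = sumℤ j (λ i → + h n x y (headIdx x k i) - + h n x y k)

-- a rotor configuration: vertex u_{k+1} (k : Fin n) gets arc a^{k+1}_{ρ k}
Rotor : ℕ → ℕ → ℕ → Set
Rotor n x y = Fin n → Fin (x ℕ.+ y)

gRotor : (n x y : ℕ) → Rotor n x y → ℤ
gRotor n x y ρ = sumFinℤ n (λ k → gArc n x y (suc (toℕ k)) (toℕ (ρ k)))

InG : ℕ → ℕ → ℕ → ℤ → Set
InG n x y w = ∃ λ (ρ : Rotor n x y) → gRotor n x y ρ ≡ w

-- CRep n x y w cs cl : (cs 0, …, cs n, cl) is a tuple c with
--   w = Σ_{k=0}^{n+1} c_k d_k,  d_k = x^{n-k} y^k,
--   c_k ∈ {0,…,y-1} for k ≤ n, c_{n+1} = cl ∈ xℤ.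
-- Since d_{n+1} = y^{n+1}/x, the equation is multiplied by x (x ≥ 1):
--   x·w = Σ_{k=0}^{n} c_k x^{n+1-k} y^k + cl·y^{n+1}.
CRep : (n x y w : ℕ) → (Fin (suc n) → ℕ) → ℤ → Set
CRep n x y w cs cl =
  (∀ k → cs k ℕ.< y) ×
  (+ x ∣ℤ cl) ×
  (+ (x ℕ.* w) ≡ + sumFinℕ (suc n) (λ k → cs k ℕ.* (x ^ (suc n ∸ toℕ k) ℕ.* y ^ toℕ k)) ℤ.+ cl ℤ.* + (y ^ suc n))

-- c[w]_{n+1} ≥ 0  (c[w] is the unique such tuple)
LastNonneg : ℕ → ℕ → ℕ → ℕ → Set
LastNonneg n x y w = ∃ λ cs → ∃ λ cl → CRep n x y w cs cl × (+ 0 ℤ.≤ cl)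

{-# OPTIONS --safe #-}
module Submission where

-- The arc a^{k+1}_j adds y^k·j·x^{n-k-1}·y to g for j ≤ x and y^k·r·x^{n-k} with r = x + y - j ∈ [1, y)
-- otherwise, so g(ρ) = Σ c_k d_k where each rotor writes a digit below y, a forward arc carrying up to x
-- into the next digit.  Let M = {Σ_{k≤n} c_k d_k : c_k ∈ ℕ}; c[w]_{n+1} ≥ 0 says exactly w ∈ M.
-- Reducing the digits of an element of M greedily modulo y, which is coprime to every power of x,
-- shows that M ⊆ g(ℛ) ∪ (M + F) and that g(ℛ) ∩ (M + F) = ∅.  Since g(ℛ) ⊆ M and M + F ⊆ M, the class
-- v + ℕF meets g(ℛ) only at the first k with v + kF ∈ M; it enters M at all by Bézout for x^n and y^n,
-- and descending by F inside M from there ends in g(ℛ) because v < F.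

open import Defs
open import Data.Nat using (ℕ; zero; suc; _+_; _*_; _∸_; _^_; _≤_; _<_; z≤n; s≤s; _≤?_; _<?_; _<ᵇ_; NonZero; >-nonZero⁻¹)
open import Data.Nat.Properties
open import Algebra.Properties.CommutativeSemigroup *-commutativeSemigroup using (x∙yz≈y∙xz)
open import Data.Nat.Coprimality as Coprimality using (Coprime; coprime-divisor; coprime-Bézout)
open import Data.Nat.Divisibility using (_∣_; divides; ∣-trans; ∣1⇒≡1; ∣m+n∣m⇒∣n; m∣m*n)
open import Data.Nat.DivMod using (_/_; _%_; m≡m%n+[m/n]*n; m%n<n)
open import Data.Nat.GCD using (module Bézout)
open import Data.Nat.Tactic.RingSolver using (solve-∀)
open import Data.Integer as ℤ using (ℤ; +_; +≤+)
import Data.Integer.Properties as ℤ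
import Data.Integer.Tactic.RingSolver as ℤ-Solver
open import Data.Fin as Fin using (Fin; toℕ; fromℕ<)
open import Data.Fin.Properties using (toℕ-fromℕ<; toℕ<n)
open import Data.Vec using (Vec; []; _∷_; map; zipWith; replicate; tabulate; _[_]%=_)
import Data.Vec.Functional as Vector
open import Data.Product using (_×_; ∃; _,_)
open import Data.Sum using (_⊎_; inj₁; inj₂)
open import Data.Empty using (⊥; ⊥-elim)
open import Data.Bool using (true; false)
open import Relation.Nullary using (¬_; yes; no; contradiction)
open import Relation.Binary.PropositionalEquality
open import Relation.Binary.Definitions using (tri<; tri≈; tri>)

sumℕ-head : ∀ m (f : ℕ → ℕ) → sumℕ (suc m) f ≡ f 0 + sumℕ m (λ i → f (suc i))
sumℕ-head zero    f = +-comm 0 (f 0)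
sumℕ-head (suc m) f = trans (cong (_+ f (suc m)) (sumℕ-head m f)) (+-assoc (f 0) _ _)

sumℕ-cong : ∀ m {f g : ℕ → ℕ} → (∀ i → f i ≡ g i) → sumℕ m f ≡ sumℕ m g
sumℕ-cong zero    f≡g = refl
sumℕ-cong (suc m) f≡g = cong₂ _+_ (sumℕ-cong m f≡g) (f≡g m)

sumℕ-*ˡ : ∀ m c (f : ℕ → ℕ) → sumℕ m (λ i → c * f i) ≡ c * sumℕ m f
sumℕ-*ˡ zero    c f = sym (*-zeroʳ c)
sumℕ-*ˡ (suc m) c f = trans (cong (_+ c * f m) (sumℕ-*ˡ m c f)) (sym (*-distribˡ-+ c _ _))

sumFinℕ-cong : ∀ m {f g : Fin m → ℕ} → (∀ i → f i ≡ g i) → sumFinℕ m f ≡ sumFinℕ m g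
sumFinℕ-cong zero    f≡g = refl
sumFinℕ-cong (suc m) f≡g = cong₂ _+_ (f≡g Fin.zero) (sumFinℕ-cong m (λ i → f≡g (Fin.suc i)))

sumFinℕ-*ˡ : ∀ m c (f : Fin m → ℕ) → sumFinℕ m (λ i → c * f i) ≡ c * sumFinℕ m f
sumFinℕ-*ˡ zero    c f = sym (*-zeroʳ c)
sumFinℕ-*ˡ (suc m) c f =
  trans (cong (λ s → c * f Fin.zero + s) (sumFinℕ-*ˡ m c (λ i → f (Fin.suc i)))) (sym (*-distribˡ-+ c _ _))

sumFinℤ-cong : ∀ m {f g : Fin m → ℤ} → (∀ i → f i ≡ g i) → sumFinℤ m f ≡ sumFinℤ m g
sumFinℤ-cong zero    f≡g = refl
sumFinℤ-cong (suc m) f≡g = cong₂ ℤ._+_ (f≡g Fin.zero) (sumFinℤ-cong m (λ i → f≡g (Fin.suc i)))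

sumFinℤ-pos : ∀ m (f : Fin m → ℕ) → sumFinℤ m (λ i → + f i) ≡ + sumFinℕ m f
sumFinℤ-pos zero    f = refl
sumFinℤ-pos (suc m) f =
  trans (cong (λ s → + f Fin.zero ℤ.+ s) (sumFinℤ-pos m (λ i → f (Fin.suc i)))) (sym (ℤ.pos-+ (f Fin.zero) _))

coprime-*ʳ : ∀ {a b c} → Coprime a b → Coprime a c → Coprime a (b * c)
coprime-*ʳ {a} {b} a⊥b a⊥c {i} (i∣a , i∣bc) = a⊥c (i∣a , coprime-divisor i⊥b i∣bc)
  where
  i⊥b : Coprime i b
  i⊥b (j∣i , j∣b) = a⊥b (∣-trans j∣i i∣a , j∣b)

coprime-^ʳ : ∀ {a b} → Coprime a b → ∀ k → Coprime a (b ^ k)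
coprime-^ʳ a⊥b zero    (_ , i∣1) = ∣1⇒≡1 i∣1
coprime-^ʳ a⊥b (suc k) = coprime-*ʳ a⊥b (coprime-^ʳ a⊥b k)

coprime-^ : ∀ {a b} → Coprime a b → ∀ i j → Coprime (a ^ i) (b ^ j)
coprime-^ a⊥b i j = Coprimality.sym (coprime-^ʳ (Coprimality.sym (coprime-^ʳ a⊥b j)) i)

module _ {y X : ℕ} {{_ : NonZero y}} (y⊥X : Coprime y X) where

  digit-shift : ∀ {a b P Q} → a ≤ b → a * X + y * P ≡ b * X + y * Q →
                ∃ λ t → b ≡ a + t * y × P ≡ Q + t * X
  digit-shift {a} {b} {P} {Q} a≤b eq = shift (coprime-divisor y⊥X y∣Xδ)
    where
    δ = b ∸ a
    yP≡ : y * P ≡ δ * X + y * Q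
    yP≡ = +-cancelˡ-≡ (a * X) _ _ (begin
      a * X + y * P           ≡⟨ eq ⟩
      b * X + y * Q           ≡⟨ cong (λ z → z * X + y * Q) (sym (m+[n∸m]≡n a≤b)) ⟩
      (a + δ) * X + y * Q     ≡⟨ cong (_+ y * Q) (*-distribʳ-+ X a δ) ⟩
      a * X + δ * X + y * Q   ≡⟨ +-assoc (a * X) _ _ ⟩
      a * X + (δ * X + y * Q) ∎)
      where open ≡-Reasoning
    y∣Xδ : y ∣ X * δ
    y∣Xδ = subst (y ∣_) (*-comm δ X)
             (∣m+n∣m⇒∣n (subst (y ∣_) (trans yP≡ (+-comm (δ * X) _)) (m∣m*n P)) (m∣m*n Q))
    regroup : ∀ t y X Q → t * y * X + y * Q ≡ y * (Q + t * X)
    regroup = solve-∀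
    shift : y ∣ δ → ∃ λ t → b ≡ a + t * y × P ≡ Q + t * X
    shift (divides t δ≡ty) = t , trans (sym (m+[n∸m]≡n a≤b)) (cong (λ z → a + z) δ≡ty) ,
      *-cancelˡ-≡ P _ y (trans yP≡ (trans (cong (λ z → z * X + y * Q) δ≡ty) (regroup t y X Q)))

  digit-≢ : ∀ {a b P Q} → b < a → a < b + y → a * X + y * P ≢ b * X + y * Q
  digit-≢ {a} {b} b<a a<b+y eq with digit-shift (<⇒≤ b<a) (sym eq)
  ... | zero  , a≡b+0 , _ = <-irrefl (sym (trans a≡b+0 (+-identityʳ b))) b<a
  ... | suc t , a≡ , _ = <⇒≱ a<b+y (subst (b + y ≤_) (sym a≡) (+-monoʳ-≤ b (m≤m+n y (t * y))))

headIdx-< : ∀ {x i} k → i < x → headIdx x k i ≡ suc k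
headIdx-< {x} {i} k i<x with i <ᵇ x | <⇒<ᵇ i<x
... | true  | _  = refl
... | false | ()

headIdx-≥ : ∀ {x i} k → x ≤ i → headIdx x k i ≡ k ∸ 1
headIdx-≥ {x} {i} k x≤i with i <ᵇ x | <ᵇ⇒< i x
... | false | _    = refl
... | true  | i<x = contradiction (i<x _) (≤⇒≯ x≤i)

module _ (x y : ℕ) where

  -- For c of length n + 1, value c = Σ_{k ≤ n} c_k d_k.
  value : ∀ {m} → Vec ℕ m → ℕ
  value []               = 0
  value {suc m} (c ∷ cs) = c * x ^ m + y * value cs

  F : ℕ → ℕ
  F m = value (replicate (suc m) 1)

  value-singleton : ∀ c → value (c ∷ []) ≡ c
  value-singleton c = trans (cong₂ _+_ (*-identityʳ c) (*-zeroʳ y)) (+-identityʳ c)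

  value-map-suc : ∀ {m} (c : Vec ℕ m) → value (map suc c) ≡ value c + value (replicate m 1)
  value-map-suc []               = refl
  value-map-suc {suc m} (c ∷ cs) =
    trans (cong (λ z → suc c * x ^ m + y * z) (value-map-suc cs)) (regroup c (x ^ m) y (value cs) _)
    where
    regroup : ∀ c X y V O → suc c * X + y * (V + O) ≡ c * X + y * V + (1 * X + y * O)
    regroup = solve-∀

  value-addHead : ∀ {m} (c : Vec ℕ (suc m)) s → value (c [ Fin.zero ]%= (_+ s)) ≡ value c + s * x ^ m
  value-addHead {m} (c ∷ cs) s = regroup c s (x ^ m) y (value cs)
    where
    regroup : ∀ c s X y V → (c + s) * X + y * V ≡ c * X + y * V + s * X
    regroup = solve-∀

  value-zipWith-+ : ∀ {m} (c d : Vec ℕ m) → value (zipWith _+_ c d) ≡ value c + value d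
  value-zipWith-+ []               []       = refl
  value-zipWith-+ {suc m} (c ∷ cs) (d ∷ ds) =
    trans (cong (λ z → (c + d) * x ^ m + y * z) (value-zipWith-+ cs ds)) (regroup c d (x ^ m) y (value cs) _)
    where
    regroup : ∀ c d X y V W → (c + d) * X + y * (V + W) ≡ c * X + y * V + (d * X + y * W)
    regroup = solve-∀

  value-replicate-0 : ∀ m → value (replicate m 0) ≡ 0
  value-replicate-0 zero    = refl
  value-replicate-0 (suc m) = trans (cong (y *_) (value-replicate-0 m)) (*-zeroʳ y)

  -- Representable n w is the condition c[w]_{n+1} ≥ 0.
  Representable : ℕ → ℕ → Set
  Representable m w = ∃ λ (c : Vec ℕ (suc m)) → value c ≡ w

  representable-0 : ∀ {m} → Representable m 0
  representable-0 {m} = replicate (suc m) 0 , value-replicate-0 (suc m)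

  representable-+ : ∀ {m a b} → Representable m a → Representable m b → Representable m (a + b)
  representable-+ (c , refl) (d , refl) = zipWith _+_ c d , value-zipWith-+ c d

  representable-* : ∀ {m a} t → Representable m a → Representable m (t * a)
  representable-* zero    _   = representable-0
  representable-* (suc t) rep = representable-+ rep (representable-* t rep)

  representable-x^ : ∀ m → Representable m (x ^ m)
  representable-x^ m = 1 ∷ replicate m 0 ,
    trans (cong (λ z → 1 * x ^ m + y * z) (value-replicate-0 m)) (trans (cong₂ _+_ (*-identityˡ _) (*-zeroʳ y)) (+-identityʳ _))

  representable-y* : ∀ {m a} → Representable m a → Representable (suc m) (y * a)
  representable-y* (c , refl) = 0 ∷ c , refl

  representable-y^ : ∀ m → Representable m (y ^ m)
  representable-y^ zero    = representable-x^ zero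
  representable-y^ (suc m) = representable-y* (representable-y^ m)

  representable-F : ∀ m → Representable m (F m)
  representable-F m = replicate (suc m) 1 , refl

  F-head : ∀ m → ∃ λ g → Representable m g × x ^ m + g ≡ F m
  F-head zero    = 0 , representable-0 , cong (λ z → 1 + z) (sym (*-zeroʳ y))
  F-head (suc m) = y * F m , representable-y* (representable-F m) , cong (_+ y * F m) (sym (*-identityˡ _))

  F-last : ∀ m → ∃ λ g → Representable m g × y ^ m + g ≡ F m
  F-last zero    = 0 , representable-0 , cong (λ z → 1 + z) (sym (*-zeroʳ y))
  F-last (suc m) with F-last m
  ... | g , rep , yᵐ+g≡F = x ^ suc m + y * g ,
    representable-+ (representable-x^ (suc m)) (representable-y* rep) ,
    trans (regroup y (y ^ m) (x ^ suc m) g) (cong (λ z → 1 * x ^ suc m + y * z) yᵐ+g≡F)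
    where
    regroup : ∀ y Y X g → y * Y + (X + y * g) ≡ 1 * X + y * (Y + g)
    regroup = solve-∀

  bigF≡F : ∀ m → bigF m x y ≡ F m
  bigF≡F zero    = cong (λ z → 1 + z) (sym (*-zeroʳ y))
  bigF≡F (suc m) = begin
    bigF (suc m) x y
      ≡⟨ sumℕ-head (suc m) _ ⟩
    x ^ suc m * 1 + sumℕ (suc m) (λ i → x ^ (m ∸ i) * (y * y ^ i))
      ≡⟨ cong₂ _+_ (*-comm (x ^ suc m) 1) (sumℕ-cong (suc m) (λ i → x∙yz≈y∙xz (x ^ (m ∸ i)) y (y ^ i))) ⟩
    1 * x ^ suc m + sumℕ (suc m) (λ i → y * (x ^ (m ∸ i) * y ^ i))
      ≡⟨ cong (λ z → 1 * x ^ suc m + z) (trans (sumℕ-*ˡ (suc m) y _) (cong (y *_) (bigF≡F m))) ⟩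
    F (suc m) ∎
    where open ≡-Reasoning

  digits-value : ∀ m (f : Fin m → ℕ) →
    sumFinℕ m (λ k → f k * (x ^ (m ∸ toℕ k) * y ^ toℕ k)) ≡ x * value (tabulate f)
  digits-value zero    f = sym (*-zeroʳ x)
  digits-value (suc m) f = begin
    f Fin.zero * (x ^ suc m * 1) + sumFinℕ m (λ k → f (Fin.suc k) * (x ^ (m ∸ toℕ k) * (y * y ^ toℕ k)))
      ≡⟨ cong (λ z → f Fin.zero * (x ^ suc m * 1) + z)
           (trans (sumFinℕ-cong m (λ k → regroup (f (Fin.suc k)) (x ^ (m ∸ toℕ k)) y (y ^ toℕ k)))
                  (trans (sumFinℕ-*ˡ m y _) (cong (y *_) (digits-value m (λ k → f (Fin.suc k)))))) ⟩
    f Fin.zero * (x * x ^ m * 1) + y * (x * value (tabulate (λ k → f (Fin.suc k))))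
      ≡⟨ factor (f Fin.zero) x (x ^ m) y _ ⟩
    x * value (tabulate f) ∎
    where
    open ≡-Reasoning
    regroup : ∀ f X y Y → f * (X * (y * Y)) ≡ y * (f * (X * Y))
    regroup = solve-∀
    factor : ∀ f x X y V → f * (x * X * 1) + y * (x * V) ≡ x * (f * X + y * V)
    factor = solve-∀

  -- The rotor at u_{k+1} contributes y ^ k * arcWeight (n ∸ suc k) j to g, where j is the index of its arc.
  arcWeight : ℕ → ℕ → ℕ
  arcWeight m j with j ≤? x
  ... | yes _ = y * (j * x ^ m)
  ... | no  _ = (x + y ∸ j) * x ^ suc m

  arcWeight-forward : ∀ m {j} → j ≤ x → arcWeight m j ≡ y * (j * x ^ m)
  arcWeight-forward m {j} j≤x with j ≤? x
  ... | yes _   = refl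
  ... | no j≰x = contradiction j≤x j≰x

  arcWeight-backward : ∀ m {j} → x < j → arcWeight m j ≡ (x + y ∸ j) * x ^ suc m
  arcWeight-backward m {j} x<j with j ≤? x
  ... | yes j≤x = contradiction j≤x (<⇒≱ x<j)
  ... | no _    = refl

  rotorWeight : ∀ m → Rotor m x y → ℕ
  rotorWeight zero    ρ = 0
  rotorWeight (suc m) ρ = arcWeight m (toℕ (Vector.head ρ)) + y * rotorWeight m (Vector.tail ρ)

  module _ (n k : ℕ) where
    private
      d : ℕ → ℕ
      d i = x ^ (n ∸ i) * y ^ i

      step : ℕ → ℤ
      step i = + h n x y (headIdx x (suc k) i) ℤ.- + h n x y (suc k)

      add-sub-cancelˡ : ∀ a b → (a ℤ.+ b) ℤ.- a ≡ b
      add-sub-cancelˡ = ℤ-Solver.solve-∀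

      sub-add-cancelˡ : ∀ a b → a ℤ.- (a ℤ.+ b) ≡ ℤ.- b
      sub-add-cancelˡ = ℤ-Solver.solve-∀

      sub-sub : ∀ a b c → (a ℤ.- b) ℤ.+ ℤ.- c ≡ a ℤ.- (c ℤ.+ b)
      sub-sub = ℤ-Solver.solve-∀

      add-sub-cancelʳ : ∀ a b → (a ℤ.+ b) ℤ.- b ≡ a
      add-sub-cancelʳ = ℤ-Solver.solve-∀

      step-forward : ∀ {i} → i < x → step i ≡ + d (suc k)
      step-forward i<x rewrite headIdx-< (suc k) i<x =
        trans (cong (ℤ._- + h n x y (suc k)) (ℤ.pos-+ (h n x y (suc k)) _)) (add-sub-cancelˡ (+ h n x y (suc k)) (+ d (suc k)))

      step-backward : ∀ {i} → x ≤ i → step i ≡ ℤ.- + d k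
      step-backward x≤i rewrite headIdx-≥ (suc k) x≤i =
        trans (cong (λ z → + h n x y k ℤ.- z) (ℤ.pos-+ (h n x y k) _)) (sub-add-cancelˡ (+ h n x y k) (+ d k))

      gArc-forward : ∀ j → j ≤ x → gArc n x y (suc k) j ≡ + (j * d (suc k))
      gArc-forward zero    _   = refl
      gArc-forward (suc j) j<x =
        trans (cong₂ ℤ._+_ (gArc-forward j (<⇒≤ j<x)) (step-forward j<x))
              (trans (sym (ℤ.pos-+ (j * d (suc k)) _)) (cong +_ (+-comm (j * d (suc k)) _)))

      gArc-backward : ∀ m → gArc n x y (suc k) (x + m) ≡ + (x * d (suc k)) ℤ.- + (m * d k)
      gArc-backward zero    = trans (cong (gArc n x y (suc k)) (+-identityʳ x))
                                    (trans (gArc-forward x ≤-refl) (sym (ℤ.+-identityʳ _)))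
      gArc-backward (suc m) = begin
        gArc n x y (suc k) (x + suc m)
          ≡⟨ cong (gArc n x y (suc k)) (+-suc x m) ⟩
        gArc n x y (suc k) (x + m) ℤ.+ step (x + m)
          ≡⟨ cong₂ ℤ._+_ (gArc-backward m) (step-backward (m≤m+n x m)) ⟩
        (+ (x * d (suc k)) ℤ.- + (m * d k)) ℤ.+ ℤ.- + d k
          ≡⟨ sub-sub (+ (x * d (suc k))) (+ (m * d k)) (+ d k) ⟩
        + (x * d (suc k)) ℤ.- (+ d k ℤ.+ + (m * d k))
          ≡⟨ cong (λ z → + (x * d (suc k)) ℤ.- z) (sym (ℤ.pos-+ (d k) _)) ⟩
        + (x * d (suc k)) ℤ.- + (suc m * d k) ∎
        where open ≡-Reasoning

    gArc≡arcWeight : k < n → ∀ {j} → j < x + y → gArc n x y (suc k) j ≡ + (y ^ k * arcWeight (n ∸ suc k) j)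
    gArc≡arcWeight k<n {j} j<x+y with x <? j
    ... | no x≮j = trans (gArc-forward j (≮⇒≥ x≮j)) (cong +_ (trans (reorder j (x ^ N) y (y ^ k))
                      (cong (y ^ k *_) (sym (arcWeight-forward N (≮⇒≥ x≮j))))))
      where
      N = n ∸ suc k
      reorder : ∀ j X y Y → j * (X * (y * Y)) ≡ Y * (y * (j * X))
      reorder = solve-∀
    ... | yes x<j = begin
        gArc n x y (suc k) j
          ≡⟨ cong (gArc n x y (suc k)) (sym (m+[n∸m]≡n x≤j)) ⟩
        gArc n x y (suc k) (x + m)
          ≡⟨ gArc-backward m ⟩
        + (x * d (suc k)) ℤ.- + (m * d k)
          ≡⟨ cong₂ (λ a b → + a ℤ.- + (m * b)) x*d[k+1]≡ dk≡P ⟩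
        + ((y ∸ m) * P + m * P) ℤ.- + (m * P)
          ≡⟨ cong (ℤ._- + (m * P)) (ℤ.pos-+ ((y ∸ m) * P) _) ⟩
        (+ ((y ∸ m) * P) ℤ.+ + (m * P)) ℤ.- + (m * P)
          ≡⟨ add-sub-cancelʳ (+ ((y ∸ m) * P)) (+ (m * P)) ⟩
        + ((y ∸ m) * P)
          ≡⟨ cong +_ (sym weight≡) ⟩
        + (y ^ k * arcWeight N j) ∎
      where
      open ≡-Reasoning
      N = n ∸ suc k
      P = x ^ suc N * y ^ k
      x≤j : x ≤ j
      x≤j = <⇒≤ x<j
      m = j ∸ x
      m≤y : m ≤ y
      m≤y = +-cancelˡ-≤ x m y (subst (_≤ x + y) (sym (m+[n∸m]≡n x≤j)) (<⇒≤ j<x+y))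
      dk≡P : d k ≡ P
      dk≡P = cong (λ e → x ^ e * y ^ k) (+-∸-assoc 1 k<n)
      reorder : ∀ x X y Y → x * (X * (y * Y)) ≡ y * (x * X * Y)
      reorder = solve-∀
      x*d[k+1]≡ : x * d (suc k) ≡ (y ∸ m) * P + m * P
      x*d[k+1]≡ = trans (reorder x (x ^ N) y (y ^ k))
                    (trans (cong (_* P) (sym (m∸n+n≡m m≤y))) (*-distribʳ-+ P (y ∸ m) m))
      reorder′ : ∀ Y r X → Y * (r * X) ≡ r * (X * Y)
      reorder′ = solve-∀
      weight≡ : y ^ k * arcWeight N j ≡ (y ∸ m) * P
      weight≡ = trans (cong (y ^ k *_) (arcWeight-backward N x<j))
                  (trans (reorder′ (y ^ k) (x + y ∸ j) (x ^ suc N))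
                    (cong (_* P) (trans (cong (x + y ∸_) (sym (m+[n∸m]≡n x≤j))) ([m+n]∸[m+o]≡n∸o x y m))))

  weightedSum≡rotorWeight : ∀ n (ρ : Rotor n x y) →
    sumFinℕ n (λ k → y ^ toℕ k * arcWeight (n ∸ suc (toℕ k)) (toℕ (ρ k))) ≡ rotorWeight n ρ
  weightedSum≡rotorWeight zero    ρ = refl
  weightedSum≡rotorWeight (suc n) ρ = cong₂ _+_ (*-identityˡ _)
    (trans (sumFinℕ-cong n (λ k → *-assoc y (y ^ toℕ k) _))
      (trans (sumFinℕ-*ˡ n y _) (cong (y *_) (weightedSum≡rotorWeight n (Vector.tail ρ)))))

  gRotor≡rotorWeight : ∀ n (ρ : Rotor n x y) → gRotor n x y ρ ≡ + rotorWeight n ρ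
  gRotor≡rotorWeight n ρ =
    trans (sumFinℤ-cong n (λ k → gArc≡arcWeight n (toℕ k) (toℕ<n k) (toℕ<n (ρ k))))
          (trans (sumFinℤ-pos n _) (cong +_ (weightedSum≡rotorWeight n ρ)))

  IsRotorWeight : ℕ → ℕ → Set
  IsRotorWeight m w = ∃ λ (ρ : Rotor m x y) → rotorWeight m ρ ≡ w

  IsRotorWeight⇒InG : ∀ {n w} → IsRotorWeight n w → InG n x y (+ w)
  IsRotorWeight⇒InG {n} (ρ , eq) = ρ , trans (gRotor≡rotorWeight n ρ) (cong +_ eq)

  InG⇒IsRotorWeight : ∀ {n w} → InG n x y (+ w) → IsRotorWeight n w
  InG⇒IsRotorWeight {n} (ρ , eq) = ρ , ℤ.+-injective (trans (sym (gRotor≡rotorWeight n ρ)) eq)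

  -- e forward arcs entering from the previous vertex, each worth x ^ m.
  carried : ∀ m → ℕ → Rotor m x y → ℕ
  carried m e ρ = e * x ^ m + rotorWeight m ρ

  carried-zero : ∀ e (ρ : Rotor 0 x y) → carried 0 e ρ ≡ e
  carried-zero e ρ = trans (+-identityʳ _) (*-identityʳ e)

  carried-forward : ∀ {m} e {j} (ρ : Rotor (suc m) x y) → arcWeight m (toℕ (Vector.head ρ)) ≡ y * (j * x ^ m) →
                    carried (suc m) e ρ ≡ e * x ^ suc m + y * carried m j (Vector.tail ρ)
  carried-forward {m} e {j} ρ w≡ = cong (λ z → e * x ^ suc m + z)
    (trans (cong (_+ y * rotorWeight m (Vector.tail ρ)) w≡) (sym (*-distribˡ-+ y (j * x ^ m) _)))

  carried-backward : ∀ {m} e {r} (ρ : Rotor (suc m) x y) → arcWeight m (toℕ (Vector.head ρ)) ≡ r * x ^ suc m →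
                     carried (suc m) e ρ ≡ (e + r) * x ^ suc m + y * carried m 0 (Vector.tail ρ)
  carried-backward {m} e {r} ρ w≡ = begin
    e * x ^ suc m + (arcWeight m (toℕ (Vector.head ρ)) + y * R) ≡⟨ cong (λ z → e * x ^ suc m + (z + y * R)) w≡ ⟩
    e * x ^ suc m + (r * x ^ suc m + y * R) ≡⟨ sym (+-assoc (e * x ^ suc m) _ _) ⟩
    e * x ^ suc m + r * x ^ suc m + y * R   ≡⟨ cong (_+ y * R) (sym (*-distribʳ-+ (x ^ suc m) e r)) ⟩
    (e + r) * x ^ suc m + y * R             ∎
    where
    open ≡-Reasoning
    R = rotorWeight m (Vector.tail ρ)

  arc-cases : ∀ m (a : Fin (x + y)) →
    (∃ λ j → j ≤ x × arcWeight m (toℕ a) ≡ y * (j * x ^ m)) ⊎ (∃ λ r → r < y × arcWeight m (toℕ a) ≡ r * x ^ suc m)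
  arc-cases m a with x <? toℕ a
  ... | no x≮a  = inj₁ (toℕ a , ≮⇒≥ x≮a , arcWeight-forward m (≮⇒≥ x≮a))
  ... | yes x<a = inj₂ (x + y ∸ toℕ a , subst (x + y ∸ toℕ a <_) (m+n∸m≡n x y) (∸-monoʳ-< x<a (<⇒≤ (toℕ<n a))) ,
                        arcWeight-backward m x<a)

  carried-representable : ∀ m e (ρ : Rotor m x y) → Representable m (carried m e ρ)
  carried-representable zero    e ρ = e ∷ [] , trans (value-singleton e) (sym (carried-zero e ρ))
  carried-representable (suc m) e ρ with arc-cases m (Vector.head ρ)
  ... | inj₁ (j , _ , w≡) with carried-representable m j (Vector.tail ρ)
  ...   | c , eq = e ∷ c , trans (cong (λ z → e * x ^ suc m + y * z) eq) (sym (carried-forward e {j} ρ w≡))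
  carried-representable (suc m) e ρ | inj₂ (r , _ , w≡) with carried-representable m 0 (Vector.tail ρ)
  ...   | c , eq = e + r ∷ c , trans (cong (λ z → (e + r) * x ^ suc m + y * z) eq) (sym (carried-backward e {r} ρ w≡))

  rotorWeight-representable : ∀ {m w} → IsRotorWeight m w → Representable m w
  rotorWeight-representable {m} (ρ , refl) = carried-representable m 0 ρ

  module _ {{_ : NonZero x}} {{_ : NonZero y}} (x⊥y : Coprime x y) (x<y : x < y) where

    forward-arc : ∀ m {j} → j ≤ x → ∃ λ (a : Fin (x + y)) → arcWeight m (toℕ a) ≡ y * (j * x ^ m)
    forward-arc m {j} j≤x = fromℕ< j<x+y , subst (λ i → arcWeight m i ≡ y * (j * x ^ m)) (sym (toℕ-fromℕ< j<x+y))
                                              (arcWeight-forward m j≤x)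
      where
      j<x+y : j < x + y
      j<x+y = ≤-<-trans j≤x (m<m+n x (>-nonZero⁻¹ y))

    backward-arc : ∀ m {r} → 0 < r → r < y → ∃ λ (a : Fin (x + y)) → arcWeight m (toℕ a) ≡ r * x ^ suc m
    backward-arc m {r} 0<r r<y = fromℕ< j<x+y , subst (λ i → arcWeight m i ≡ r * x ^ suc m) (sym (toℕ-fromℕ< j<x+y))
                                                   (trans (arcWeight-backward m x<j) (cong (_* x ^ suc m) (m∸[m∸n]≡n r≤x+y)))
      where
      r≤x+y : r ≤ x + y
      r≤x+y = ≤-trans (<⇒≤ r<y) (m≤n+m y x)
      j<x+y : x + y ∸ r < x + y
      j<x+y = ∸-monoʳ-< 0<r r≤x+y
      x<j : x < x + y ∸ r
      x<j = subst (x <_) (sym (+-∸-assoc x (<⇒≤ r<y))) (m<m+n x (m<n⇒0<n∸m r<y))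

    value-carry : ∀ {m} c (cs : Vec ℕ (suc m)) →
                  value (c ∷ cs) ≡ c % y * x ^ suc m + y * value (cs [ Fin.zero ]%= (_+ c / y * x))
    value-carry {m} c cs = begin
      c * x ^ suc m + y * value cs
        ≡⟨ cong (λ z → z * x ^ suc m + y * value cs) (m≡m%n+[m/n]*n c y) ⟩
      (c % y + c / y * y) * (x * x ^ m) + y * value cs
        ≡⟨ regroup (c % y) (c / y) y x (x ^ m) (value cs) ⟩
      c % y * x ^ suc m + y * (value cs + c / y * x * x ^ m)
        ≡⟨ cong (λ z → c % y * x ^ suc m + y * z) (sym (value-addHead cs (c / y * x))) ⟩
      c % y * x ^ suc m + y * value (cs [ Fin.zero ]%= (_+ c / y * x)) ∎
      where
      open ≡-Reasoning
      regroup : ∀ r q y x X V → (r + q * y) * (x * X) + y * V ≡ r * (x * X) + y * (V + q * x * X)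
      regroup = solve-∀

    y⊥x^ : ∀ m → Coprime y (x ^ m)
    y⊥x^ = coprime-^ʳ (Coprimality.sym x⊥y)

    Split : ℕ → ℕ → ℕ → Set
    Split b m w = (∃ λ e → e ≤ b × ∃ λ ρ → carried m e ρ ≡ w) ⊎
                  (∃ λ (c : Vec ℕ (suc m)) → value c + F m + b * x ^ m ≡ w)

    split-excess : ∀ {m b t} (c : Vec ℕ (suc m)) → suc b ≤ t →
                   value (t ∸ suc b ∷ c) + F (suc m) + b * x ^ suc m ≡ t * x ^ suc m + y * (value c + F m)
    split-excess {m} {b} {t} c b<t =
      trans (regroup (t ∸ suc b) b (x ^ suc m) y (value c) (F m)) (cong (λ z → z * x ^ suc m + y * (value c + F m)) (m∸n+n≡m b<t))
      where
      regroup : ∀ s b X y V G → s * X + y * V + (1 * X + y * G) + b * X ≡ (s + suc b) * X + y * (V + G)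
      regroup = solve-∀

    -- The leading digit is reduced modulo y; a digit r ≤ b is read as r entering forward arcs (the next
    -- vertex may then receive up to x of its own), a larger one as a backward arc of weight r.
    mutual
      value-split : ∀ {b} → b ≤ x → ∀ m (c : Vec ℕ (suc m)) → Split b m (value c)
      value-split {b} _ zero (c ∷ []) with c ≤? b
      ... | yes c≤b = inj₁ (c , c≤b , (λ ()) , trans (carried-zero c (λ ())) (sym (value-singleton c)))
      ... | no c≰b  = inj₂ (c ∸ suc b ∷ [] , (begin
        value (c ∸ suc b ∷ []) + F 0 + b * 1 ≡⟨ cong₂ (λ u v → u + v + b * 1) (value-singleton (c ∸ suc b)) (value-singleton 1) ⟩
        c ∸ suc b + 1 + b * 1               ≡⟨ regroup (c ∸ suc b) b ⟩
        c ∸ suc b + suc b                   ≡⟨ m∸n+n≡m (≰⇒> c≰b) ⟩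
        c                                   ≡⟨ sym (value-singleton c) ⟩
        value (c ∷ [])                      ∎))
        where
        open ≡-Reasoning
        regroup : ∀ s b → s + 1 + b * 1 ≡ s + suc b
        regroup = solve-∀
      value-split b≤x (suc m) (c ∷ cs) = subst (Split _ (suc m)) (sym (value-carry c cs))
                                     (digit-split b≤x m (m%n<n c y) (cs [ Fin.zero ]%= (_+ c / y * x)))

      digit-split : ∀ {b} → b ≤ x → ∀ m {r} → r < y → (cs : Vec ℕ (suc m)) →
                    Split b (suc m) (r * x ^ suc m + y * value cs)
      digit-split {b} b≤x m {r} r<y cs with r ≤? b
      ... | yes r≤b with value-split ≤-refl m cs
      ...   | inj₁ (e , e≤x , ρ , eq) with forward-arc m e≤x
      ...     | a , w≡ = inj₁ (r , r≤b , a Vector.∷ ρ ,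
                           trans (carried-forward r {e} (a Vector.∷ ρ) w≡) (cong (λ z → r * x ^ suc m + y * z) eq))
      digit-split {b} b≤x m {r} r<y cs | yes r≤b | inj₂ (c , eq) = inj₂ (r + y ∸ suc b ∷ c ,
          trans (split-excess c (≤-trans (s≤s b≤x) (≤-trans x<y (m≤n+m y r))))
                (trans (regroup r y (x ^ suc m) (value c + F m)) (cong (λ z → r * x ^ suc m + y * z) eq)))
        where
        regroup : ∀ r y X W → (r + y) * X + y * W ≡ r * X + y * (W + X)
        regroup = solve-∀
      digit-split {b} b≤x m {r} r<y cs | no r≰b with value-split z≤n m cs
      ...   | inj₁ (.0 , z≤n , ρ , eq) with backward-arc m (≤-<-trans z≤n (≰⇒> r≰b)) r<y
      ...     | a , w≡ = inj₁ (0 , z≤n , a Vector.∷ ρ ,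
                           trans (carried-backward 0 {r} (a Vector.∷ ρ) w≡) (cong (λ z → r * x ^ suc m + y * z) eq))
      digit-split {b} b≤x m {r} r<y cs | no r≰b | inj₂ (c , eq) = inj₂ (r ∸ suc b ∷ c ,
          trans (split-excess c (≰⇒> r≰b))
                (cong (λ z → r * x ^ suc m + y * z) (trans (sym (+-identityʳ _)) eq)))

    shifted-addHead : ∀ {m} g (γ : Vec ℕ m) t →
                   value (map suc (g ∷ γ)) + t * x ^ suc m ≡ value (map suc (g + t * x ∷ γ))
    shifted-addHead g γ t = trans (cong (λ z → value (map suc (g ∷ γ)) + z) (sym (*-assoc t x _)))
                               (sym (value-addHead (map suc (g ∷ γ)) (t * x)))

    -- The leading digits agree modulo y, as y is coprime to x ^ suc m.  The invariant e ≤ g makes the right one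
    -- exceed the left one by a multiple of y, positive after a forward arc; moved into the tail this restores
    -- the invariant, until the last vertex demands e = suc g.
    carried≢shifted : ∀ m e (ρ : Rotor m x y) g (γ : Vec ℕ m) → e ≤ g → carried m e ρ ≢ value (map suc (g ∷ γ))
    carried≢shifted zero e ρ g [] e≤g eq =
      <-irrefl (trans (sym (carried-zero e ρ)) (trans eq (value-singleton (suc g)))) (s≤s e≤g)
    carried≢shifted (suc m) e ρ g (g′ ∷ γ) e≤g eq = by-arc (arc-cases m (Vector.head ρ))
      where
      X = x ^ suc m
      Q = value (map suc (g′ ∷ γ))
      by-arc : (∃ λ j → j ≤ x × arcWeight m (toℕ (Vector.head ρ)) ≡ y * (j * x ^ m)) ⊎
               (∃ λ r → r < y × arcWeight m (toℕ (Vector.head ρ)) ≡ r * X) → ⊥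
      by-arc (inj₁ (j , j≤x , w≡)) = forward (digit-shift (y⊥x^ (suc m)) (m≤n⇒m≤1+n e≤g) (trans (sym (carried-forward e {j} ρ w≡)) eq))
        where
        forward : (∃ λ t → suc g ≡ e + t * y × carried m j (Vector.tail ρ) ≡ Q + t * X) → ⊥
        forward (zero  , g+1≡e+0 , _) = <-irrefl (sym (trans g+1≡e+0 (+-identityʳ e))) (s≤s e≤g)
        forward (suc t , _ , P≡) = carried≢shifted m j (Vector.tail ρ) (g′ + suc t * x) γ
                               (≤-trans j≤x (≤-trans (m≤m+n x (t * x)) (m≤n+m _ g′))) (trans P≡ (shifted-addHead g′ γ (suc t)))
      by-arc (inj₂ (r , r<y , w≡)) with e + r ≤? suc g
      ... | yes e+r≤ = backward (digit-shift (y⊥x^ (suc m)) e+r≤ eq′)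
        where
        eq′ = trans (sym (carried-backward e {r} ρ w≡)) eq
        backward : (∃ λ t → suc g ≡ e + r + t * y × carried m 0 (Vector.tail ρ) ≡ Q + t * X) → ⊥
        backward (t , _ , P≡) = carried≢shifted m 0 (Vector.tail ρ) (g′ + t * x) γ z≤n (trans P≡ (shifted-addHead g′ γ t))
      ... | no e+r≰ =
        digit-≢ (y⊥x^ (suc m)) (≰⇒> e+r≰) (s≤s (+-mono-≤ e≤g (<⇒≤ r<y))) (trans (sym (carried-backward e {r} ρ w≡)) eq)

    rotorWeight-or-shifted : ∀ {m w} → Representable m w → IsRotorWeight m w ⊎ ∃ λ w′ → Representable m w′ × w ≡ w′ + F m
    rotorWeight-or-shifted {m} (c , refl) with value-split z≤n m c
    ... | inj₁ (.0 , z≤n , ρ , eq) = inj₁ (ρ , eq)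
    ... | inj₂ (c′ , eq)           = inj₂ (value c′ , (c′ , refl) , trans (sym eq) (+-identityʳ _))

    rotorWeight-not-shifted : ∀ {m w} → Representable m w → ¬ IsRotorWeight m (w + F m)
    rotorWeight-not-shifted {m} (g ∷ γ , refl) (ρ , eq) = carried≢shifted m 0 ρ g γ z≤n (trans eq (sym (value-map-suc (g ∷ γ))))

    shift-representable : ∀ n v → ∃ λ k → Representable n (v + k * F n)
    shift-representable n v = from-Bézout (coprime-Bézout (coprime-^ x⊥y n n))
      where
      -- From 1 + b X = a Z:  v + v b F = v a Z + v b g  whenever  F = X + g.
      combine : ∀ {X Z} a b → 1 + b * X ≡ a * Z → Representable n Z → (∃ λ g → Representable n g × X + g ≡ F n) →
                Representable n (v + v * b * F n)
      combine {X} {Z} a b eq rep-Z (g , rep-g , X+g≡F) =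
        subst (Representable n) v·aZ+v·bg≡ (representable-+ (representable-* (v * a) rep-Z) (representable-* (v * b) rep-g))
        where
        regroup : ∀ v b X g → v * (1 + b * X) + v * b * g ≡ v + v * b * (X + g)
        regroup = solve-∀
        v·aZ+v·bg≡ : v * a * Z + v * b * g ≡ v + v * b * F n
        v·aZ+v·bg≡ = trans (cong (_+ v * b * g) (trans (*-assoc v a Z) (cong (v *_) (sym eq))))
                           (trans (regroup v b X g) (cong (λ z → v + v * b * z) X+g≡F))
      from-Bézout : Bézout.Identity 1 (x ^ n) (y ^ n) → ∃ λ k → Representable n (v + k * F n)
      from-Bézout (Bézout.+- a b eq) = v * b , combine a b eq (representable-x^ n) (F-last n)
      from-Bézout (Bézout.-+ a b eq) = v * a , combine b a eq (representable-y^ n) (F-head n)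

    descend : ∀ {n v} → v < F n → ∀ k → Representable n (v + k * F n) → ∃ λ k′ → IsRotorWeight n (v + k′ * F n)
    descend {n} {v} v<F k rep with rotorWeight-or-shifted rep
    ... | inj₁ hit = k , hit
    descend {n} {v} v<F zero    rep | inj₂ (w′ , _ , v+0≡w′+F) =
      ⊥-elim (<⇒≱ v<F (≤-trans (m≤n+m (F n) w′) (≤-reflexive (trans (sym v+0≡w′+F) (+-identityʳ v)))))
    descend {n} {v} v<F (suc k) rep | inj₂ (w′ , rep′ , eq) =
      descend v<F k (subst (Representable n) (+-cancelʳ-≡ (F n) w′ _ (trans (sym eq) (regroup v k (F n)))) rep′)
      where
      regroup : ∀ v k F → v + (F + k * F) ≡ v + k * F + F
      regroup = solve-∀

    never-returns : ∀ {n v a b} → a < b → Representable n (v + a * F n) → ¬ IsRotorWeight n (v + b * F n)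
    never-returns {n} {v} {a} {b} a<b rep hit =
      rotorWeight-not-shifted (representable-+ rep (representable-* d (representable-F n)))
        (subst (IsRotorWeight n) (trans (cong (λ z → v + z * F n) (sym (m+[n∸m]≡n a<b))) (regroup v a d (F n))) hit)
      where
      d = b ∸ suc a
      regroup : ∀ v a d F → v + (suc a + d) * F ≡ v + a * F + d * F + F
      regroup = solve-∀

    normalise : ∀ {m} (c : Vec ℕ (suc m)) →
                ∃ λ (ds : Fin (suc m) → ℕ) → ∃ λ q → (∀ i → ds i < y) × value c ≡ value (tabulate ds) + q * y ^ suc m
    normalise {zero} (c ∷ []) = (λ _ → c % y) , c / y , (λ _ → m%n<n c y) ,
      trans (cong (λ z → z * 1 + y * 0) (m≡m%n+[m/n]*n c y)) (regroup (c % y) (c / y) y)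
      where
      regroup : ∀ r q y → (r + q * y) * 1 + y * 0 ≡ r * 1 + y * 0 + q * (y * 1)
      regroup = solve-∀
    normalise {suc m} (c ∷ cs) with normalise (cs [ Fin.zero ]%= (_+ c / y * x))
    ... | ds , q , ds<y , eq = c % y Vector.∷ ds , q , (λ { Fin.zero → m%n<n c y ; (Fin.suc i) → ds<y i }) ,
      trans (value-carry c cs) (trans (cong (λ z → c % y * x ^ suc m + y * z) eq)
                                      (regroup (c % y) (x ^ suc m) y (value (tabulate ds)) q (y ^ suc m)))
      where
      regroup : ∀ r X y V q Y → r * X + y * (V + q * Y) ≡ r * X + y * V + q * (y * Y)
      regroup = solve-∀

    Representable⇒LastNonneg : ∀ {n w} → Representable n w → LastNonneg n x y w
    Representable⇒LastNonneg {n} (c , refl) with normalise c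
    ... | ds , q , ds<y , eq = ds , + (q * x) , (ds<y , divides q refl , eqℤ) , +≤+ z≤n
      where
      S = sumFinℕ (suc n) (λ k → ds k * (x ^ (suc n ∸ toℕ k) * y ^ toℕ k))
      regroup : ∀ x V q Y → x * (V + q * Y) ≡ x * V + q * x * Y
      regroup = solve-∀
      eqℕ : x * value c ≡ S + q * x * y ^ suc n
      eqℕ = trans (cong (x *_) eq) (trans (regroup x _ q _) (cong (_+ q * x * y ^ suc n) (sym (digits-value (suc n) ds))))
      eqℤ : + (x * value c) ≡ + S ℤ.+ + (q * x) ℤ.* + (y ^ suc n)
      eqℤ = trans (cong +_ eqℕ) (trans (ℤ.pos-+ S _) (cong (λ z → + S ℤ.+ z) (ℤ.pos-* (q * x) _)))

    LastNonneg⇒Representable : ∀ {n w} → LastNonneg n x y w → Representable n w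
    LastNonneg⇒Representable {n} {w} (cs , + c , (_ , divides q c≡qx , eq) , _) =
      subst (Representable n) (sym w≡) (representable-+ (tabulate cs , refl) (representable-* (q * y) (representable-y^ n)))
      where
      V = value (tabulate cs)
      S = sumFinℕ (suc n) (λ k → cs k * (x ^ (suc n ∸ toℕ k) * y ^ toℕ k))
      regroup : ∀ x V q y Y → x * V + q * x * (y * Y) ≡ x * (V + q * y * Y)
      regroup = solve-∀
      xw≡ : x * w ≡ S + c * y ^ suc n
      xw≡ = ℤ.+-injective (trans eq (trans (cong (λ z → + S ℤ.+ z) (sym (ℤ.pos-* c _))) (sym (ℤ.pos-+ S _))))
      w≡ : w ≡ V + q * y * y ^ n
      w≡ = *-cancelˡ-≡ w _ x (trans xw≡ (trans (cong₂ (λ s k → s + k * y ^ suc n) (digits-value (suc n) cs) c≡qx)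
                                                (regroup x V q y _)))

    unique-shift : ∀ n v → v < bigF n x y →
      ∃ λ (k : ℕ) →
        (InG n x y (+ (v + k * bigF n x y)) × (∀ (k′ : ℕ) → InG n x y (+ (v + k′ * bigF n x y)) → k′ ≡ k)) ×
        (LastNonneg n x y (v + k * bigF n x y) × (∀ (k′ : ℕ) → LastNonneg n x y (v + k′ * bigF n x y) → k ≤ k′))
    unique-shift n v v<bigF rewrite bigF≡F n with shift-representable n v
    ... | k₀ , rep₀ with descend v<bigF k₀ rep₀
    ... | k , hit = k , (IsRotorWeight⇒InG hit , unique) , (Representable⇒LastNonneg (rotorWeight-representable hit) , minimal)
      where
      unique : ∀ k′ → InG n x y (+ (v + k′ * F n)) → k′ ≡ k
      unique k′ inG with <-cmp k′ k
      ... | tri< k′<k _ _ = ⊥-elim (never-returns k′<k (rotorWeight-representable (InG⇒IsRotorWeight inG)) hit)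
      ... | tri≈ _ k′≡k _ = k′≡k
      ... | tri> _ _ k<k′ = ⊥-elim (never-returns k<k′ (rotorWeight-representable hit) (InG⇒IsRotorWeight inG))
      minimal : ∀ k′ → LastNonneg n x y (v + k′ * F n) → k ≤ k′
      minimal k′ last = ≮⇒≥ (λ k′<k → never-returns k′<k (LastNonneg⇒Representable last) hit)

lemma9 : (n x y : ℕ) → 1 ≤ n → Coprime x y → 1 ≤ x → x < y →
         (v : ℕ) → v < bigF n x y →
         ∃ λ (k : ℕ) →
           (InG n x y (+ (v + k * bigF n x y)) ×
            (∀ (k′ : ℕ) → InG n x y (+ (v + k′ * bigF n x y)) → k′ ≡ k)) ×
           (LastNonneg n x y (v + k * bigF n x y) ×
            (∀ (k′ : ℕ) → LastNonneg n x y (v + k′ * bigF n x y) → k ≤ k′))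
lemma9 n zero    y       _ _   ()  _   v v<F
lemma9 n (suc x) zero    _ _   _   ()  v v<F
lemma9 n (suc x) (suc y) _ x⊥y _ x<y v v<F = unique-shift (suc x) (suc y) x⊥y x<y n v v<F
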